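{- Let $\Sigma,\Gamma$ be finite alphabets with at least two letters each and $\mathcal{I}$ the set of injective morphisms $\Sigma^*\to\Gamma^*$. Let $w,u\in\Sigma^{\mathbb{N}}$ be infinite words with $w=pu$ for some finite word $p\in\Sigma^*$. Then $\mathrm{ACE}_{\mathcal{I}}(w)=\mathrm{ACE}_{\mathcal{I}}(u)$.
   Context: For a nonempty word $v$ and natural number $q$, $v^{q/|v|}$ is the prefix of length $q$ of $vvv\cdots$. The fractional exponent of a nonempty finite word $z$ is $\mathrm{E}(z)=\sup\{r\in\mathbb{Q}\mid\exists v\ne\varepsilon: z=v^r\}$. For an infinite word $w$, $\mathrm{ACE}(w)=\lim_{N\to\infty}\sup\{\mathrm{E}(z)\mid z\text{ a factor of } w,\ |z|\ge N\}$, and $\mathrm{ACE}_{\mathcal{I}}(w)=\sup\{\mathrm{ACE}(h(w))\mid h\in\mathcal{I}\}$. -}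

module Defs where

open import Data.Nat using (ℕ; zero; suc; _+_; _≤_; _<_; _∸_; _<?_)
open import Data.Nat.DivMod using (_mod_)
open import Data.List using (List; []; _∷_; length; lookup; map; upTo; concatMap; take; _++_)
open import Data.Fin using (Fin; fromℕ<)
open import Data.Integer using (+_)
open import Data.Rational using (ℚ; _/_) renaming (_<_ to _<ℚ_)
open import Data.Product using (Σ; ∃; _×_; _,_)
open import Relation.Binary.PropositionalEquality using (_≡_)
open import Relation.Nullary using (yes; no)

InfWord : Set → Set
InfWord A = ℕ → A

prefix : {A : Set} → ℕ → InfWord A → List A
prefix n w = map w (upTo n)

prepend : {A : Set} → List A → InfWord A → InfWord A
prepend p u i with i <? length p
... | yes i<p = lookup p (fromℕ< i<p)
... | no _    = u (i ∸ length p)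

FactorOfList : {A : Set} → List A → List A → Set
FactorOfList {A} z x = Σ (List A) λ s → Σ (List A) λ t → x ≡ s ++ z ++ t

FactorOfInf : {A : Set} → List A → InfWord A → Set
FactorOfInf z w = ∃ λ i → z ≡ map (λ j → w (i + j)) (upTo (length z))

Morphism : Set → Set → Set
Morphism S G = S → List G

ext : {S G : Set} → Morphism S G → List S → List G
ext h = concatMap h

Injective : {S G : Set} → Morphism S G → Set
Injective h = ∀ x y → ext h x ≡ ext h y → x ≡ y

-- z is a factor of the (image) infinite word h(w):
-- equivalently, z is a factor of h(prefix of w of some length n)
FactorOfImage : {S G : Set} → List G → Morphism S G → InfWord S → Set
FactorOfImage z h w = ∃ λ n → FactorOfList z (ext h (prefix n w))

-- v^{q/|v|}: the prefix of length q of v v v ..., for the nonempty word v = a ∷ v'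
power : {A : Set} → A → List A → ℕ → List A
power a v q = map (λ j → lookup (a ∷ v) (j mod length (a ∷ v))) (upTo q)

-- r < E(z): some representation z = v^{q/|v|} (v nonempty) has exponent q/|v| > r
ExpAbove : {A : Set} → List A → ℚ → Set
ExpAbove {A} z r = Σ A λ a → Σ (List A) λ v → Σ ℕ λ q →
  (z ≡ power a v q) × (r <ℚ ((+ q) / length (a ∷ v)))

-- r < ACE(x), where Fac is the set of factors of the infinite word x.
-- ACE(x) = lim_N s_N with s_N = sup{E(z) | z factor, |z| ≥ N} non-increasing,
-- so r < ACE(x) iff ∃ r' > r, ∀ N, ∃ factor z with |z| ≥ N and E(z) > r'.
ACEAbove : {A : Set} → (List A → Set) → ℚ → Set
ACEAbove {A} Fac r = ∃ λ r' → (r <ℚ r') ×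
  (∀ N → Σ (List A) λ z → Fac z × (N ≤ length z) × ExpAbove z r')

-- r < ACE_I(w) = sup { ACE(h(w)) | h : Σ* → Γ* injective morphism }
ACEIAbove : {S : Set} (G : Set) → InfWord S → ℚ → Set
ACEIAbove G w r = Σ (Morphism _ G) λ h → Injective h ×
  ACEAbove (λ z → FactorOfImage z h w) r

-- The same injective morphism h serves for w and for u, because h(w) = h(p) h(u).
-- Every factor of h(u) is a factor of h(w); conversely, a factor of h(w) becomes a
-- factor of h(u) once at most |h(p)| leading letters are deleted. Deleting e ≤ D
-- letters from a power v^{q/|v|} leaves a power of a conjugate of v with exponent
-- (q − e)/|v|, and for long enough factors this stays above any r'' < r' when the
-- original exponent exceeded r': if |v| is large the loss e/|v| is small, and if
-- |v| is small the exponent q/|v| is huge anyway.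
module Submission where

open import Defs
open import Data.Nat using (ℕ; zero; suc; _+_; _*_; _∸_; _≤_; _<_; _%_; _<?_; z≤n; s≤s; s≤s⁻¹; NonZero; >-nonZero⁻¹)
open import Data.Nat.Properties
open import Data.Nat.DivMod using (_mod_; m%n%n≡m%n; %-distribˡ-+)
open import Data.Nat.Tactic.RingSolver using (solve)
open import Data.Fin using (Fin; toℕ; fromℕ<)
open import Data.Fin.Properties using (toℕ-injective; toℕ-fromℕ<; fromℕ<-cong)
open import Data.Integer as ℤ using (+_; -[1+_]; +<+)
import Data.Integer.Properties as ℤP
open import Data.Rational using (ℚ; mkℚ; _/_; *<*) renaming (_<_ to _<ℚ_)
import Data.Rational.Properties as ℚP
import Data.Rational.Unnormalised as ℚᵘ
import Data.Rational.Unnormalised.Properties as ℚᵘP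
open import Data.Nat.Coprimality using (Coprime)
open import Data.List using (List; []; _∷_; length; lookup; map; upTo; applyUpTo; drop; _++_)
open import Data.List.Properties
  using (map-cong; map-upTo; length-map; length-upTo; length-applyUpTo; lookup-applyUpTo; length-drop; concatMap-++; ++-assoc; ∷-injectiveʳ)
open import Data.Product using (Σ; ∃; ∃₂; _×_; _,_; proj₁; proj₂)
open import Data.Empty using (⊥-elim)
open import Function using (_∘_)
open import Relation.Binary.PropositionalEquality
open import Relation.Nullary using (Dec; yes; no; ¬_)

[m+n%o]%o≡[m+n]%o : ∀ m n o .{{_ : NonZero o}} → (m + n % o) % o ≡ (m + n) % o
[m+n%o]%o≡[m+n]%o m n o = begin
  (m + n % o) % o            ≡⟨ %-distribˡ-+ m (n % o) o ⟩
  (m % o + n % o % o) % o    ≡⟨ cong (λ k → (m % o + k) % o) (m%n%n≡m%n n o) ⟩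
  (m % o + n % o) % o        ≡⟨ %-distribˡ-+ m n o ⟨
  (m + n) % o                ∎
  where open ≡-Reasoning

-- Short periods L < M = D d d′ are handled by q being large, long ones by the loss e d
-- being at most L, which the slack between n₀/d and n′/d′ absorbs.
trim-threshold-ℕ : ∀ n₀ n′ d d′ D .{{_ : NonZero d}} → n₀ * d′ < n′ * d →
  ∃ λ B → ∀ q L e → e ≤ D → B ≤ q → n′ * L < q * d′ → n₀ * L < (q ∸ e) * d
trim-threshold-ℕ n₀ n′ d d′ D x<y = suc (n₀ * M + D) , bound
  where
  M = D * d * d′
  open ≤-Reasoning

  bound : ∀ q L e → e ≤ D → suc (n₀ * M + D) ≤ q → n′ * L < q * d′ → n₀ * L < (q ∸ e) * d
  bound q L e e≤D B≤q y<q/L rewrite *-distribʳ-∸ d q e = m+n≤o⇒m≤o∸n (suc (n₀ * L)) (lossAbsorbed (L <? M))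
    where
    lossAbsorbed : Dec (L < M) → n₀ * L + e * d < q * d
    lossAbsorbed (yes L<M) = begin-strict
      n₀ * L + e * d         ≤⟨ +-mono-≤ (*-monoʳ-≤ n₀ (<⇒≤ L<M)) (*-monoˡ-≤ d e≤D) ⟩
      n₀ * M + D * d         ≤⟨ +-monoˡ-≤ (D * d) (m≤m*n (n₀ * M) d) ⟩
      n₀ * M * d + D * d     ≡⟨ *-distribʳ-+ d (n₀ * M) D ⟨
      (n₀ * M + D) * d       <⟨ m<n+m ((n₀ * M + D) * d) (>-nonZero⁻¹ d) ⟩
      suc (n₀ * M + D) * d   ≤⟨ *-monoˡ-≤ d B≤q ⟩
      q * d                  ∎
    lossAbsorbed (no L≮M) = *-cancelʳ-< d′ _ _ (begin-strict
      (n₀ * L + e * d) * d′  ≡⟨ solve (n₀ ∷ L ∷ e ∷ d ∷ d′ ∷ []) ⟩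
      n₀ * d′ * L + e * d * d′
        ≤⟨ +-monoʳ-≤ (n₀ * d′ * L) (≤-trans (*-monoˡ-≤ d′ (*-monoˡ-≤ d e≤D)) (≮⇒≥ L≮M)) ⟩
      n₀ * d′ * L + L        ≡⟨ +-comm (n₀ * d′ * L) L ⟩
      suc (n₀ * d′) * L      ≤⟨ *-monoˡ-≤ L x<y ⟩
      n′ * d * L             ≡⟨ solve (n′ ∷ d ∷ L ∷ []) ⟩
      n′ * L * d             <⟨ m<n+m (n′ * L * d) (>-nonZero⁻¹ d) ⟩
      suc (n′ * L) * d       ≤⟨ *-monoˡ-≤ d y<q/L ⟩
      q * d′ * d             ≡⟨ solve (q ∷ d′ ∷ d ∷ []) ⟩
      q * d * d′             ∎)

pos-*-<⁺ : ∀ m n o p → m * n < o * p → + m ℤ.* + n ℤ.< + o ℤ.* + p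
pos-*-<⁺ m n o p mn<op = subst₂ ℤ._<_ (ℤP.pos-* m n) (ℤP.pos-* o p) (+<+ mn<op)

pos-*-<⁻ : ∀ m n o p → + m ℤ.* + n ℤ.< + o ℤ.* + p → m * n < o * p
pos-*-<⁻ m n o p mn<op = ℤP.drop‿+<+ (subst₂ ℤ._<_ (sym (ℤP.pos-* m n)) (sym (ℤP.pos-* o p)) mn<op)

-- q / suc l is normalised, so the comparison goes through its unnormalised form.
<[/]⇒*< : ∀ {n a} .{c : Coprime ℤ.∣ n ∣ (suc a)} q l →
  mkℚ n a c <ℚ + q / suc l → n ℤ.* + suc l ℤ.< + q ℤ.* + suc a
<[/]⇒*< q l x<q/l
  with ℚᵘP.<-respʳ-≃ (ℚP.toℚᵘ-fromℚᵘ (ℚᵘ.mkℚᵘ (+ q) l)) (ℚP.toℚᵘ-mono-< x<q/l)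
... | ℚᵘ.*<* cross = cross

*<⇒<[/] : ∀ {n a} .{c : Coprime ℤ.∣ n ∣ (suc a)} q l →
  n ℤ.* + suc l ℤ.< + q ℤ.* + suc a → mkℚ n a c <ℚ + q / suc l
*<⇒<[/] q l cross =
  ℚP.toℚᵘ-cancel-< (ℚᵘP.<-respʳ-≃ (ℚᵘP.≃-sym (ℚP.toℚᵘ-fromℚᵘ (ℚᵘ.mkℚᵘ (+ q) l))) (ℚᵘ.*<* cross))

trim-threshold : ∀ {x y : ℚ} → x <ℚ y → (D : ℕ) →
  ∃ λ B → ∀ q l e → e ≤ D → B ≤ q → y <ℚ + q / suc l → x <ℚ + (q ∸ e) / suc l
trim-threshold {x@(mkℚ -[1+ _ ] _ _)} _ D = 0 , λ q l e _ _ _ →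
  ℚP.<-≤-trans (ℚP.negative⁻¹ x) (ℚP.nonNegative⁻¹ _ {{ℚP.normalize-nonNeg (q ∸ e) (suc l)}})
trim-threshold {x@(mkℚ (+ _) _ _)} {y@(mkℚ -[1+ _ ] _ _)} x<y D =
  ⊥-elim (ℚP.<-irrefl refl (ℚP.<-≤-trans (ℚP.<-trans x<y (ℚP.negative⁻¹ y)) (ℚP.nonNegative⁻¹ x)))
trim-threshold {mkℚ (+ n₀) a _} {mkℚ (+ n′) b _} (*<* x<y) D
  with trim-threshold-ℕ n₀ n′ (suc a) (suc b) D (pos-*-<⁻ n₀ (suc b) n′ (suc a) x<y)
... | B , bound = B , λ q l e e≤D B≤q y<q/l →
  *<⇒<[/] (q ∸ e) l (pos-*-<⁺ n₀ (suc l) (q ∸ e) (suc a)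
    (bound q (suc l) e e≤D B≤q (pos-*-<⁻ n′ (suc l) q (suc b) (<[/]⇒*< q l y<q/l))))

applyUpTo-cong : ∀ {A : Set} {f g : ℕ → A} → f ≗ g → applyUpTo f ≗ applyUpTo g
applyUpTo-cong f≗g zero    = refl
applyUpTo-cong f≗g (suc n) = cong₂ _∷_ (f≗g 0) (applyUpTo-cong (f≗g ∘ suc) n)

applyUpTo-+ : ∀ {A : Set} (f : ℕ → A) m n → applyUpTo f (m + n) ≡ applyUpTo f m ++ applyUpTo (λ i → f (m + i)) n
applyUpTo-+ f zero    n = refl
applyUpTo-+ f (suc m) n = cong (f 0 ∷_) (applyUpTo-+ (f ∘ suc) m n)

drop-applyUpTo : ∀ {A : Set} (f : ℕ → A) e n → drop e (applyUpTo f n) ≡ applyUpTo (λ i → f (e + i)) (n ∸ e)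
drop-applyUpTo f zero    n       = refl
drop-applyUpTo f (suc e) zero    = refl
drop-applyUpTo f (suc e) (suc n) = drop-applyUpTo (f ∘ suc) e n

cycle : {A : Set} → A → List A → ℕ → A
cycle a v j = lookup (a ∷ v) (j mod length (a ∷ v))

length-power : ∀ {A : Set} (a : A) v q → length (power a v q) ≡ q
length-power a v q = trans (length-map (cycle a v) (upTo q)) (length-upTo q)

cycle-cong-% : ∀ {A : Set} (a : A) v i j → i % length (a ∷ v) ≡ j % length (a ∷ v) → cycle a v i ≡ cycle a v j
cycle-cong-% a v i j i≡j = cong (lookup (a ∷ v)) (toℕ-injective (trans (toℕ-fromℕ< _) (trans i≡j (sym (toℕ-fromℕ< _)))))

cycle-rotate : ∀ {A : Set} (a : A) v e →
  ∃₂ λ a′ v′ → length v′ ≡ length v × (∀ j → cycle a′ v′ j ≡ cycle a v (e + j))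
cycle-rotate a v e = g 0 , applyUpTo (g ∘ suc) l , length-applyUpTo (g ∘ suc) l , rotated
  where
  l = length v
  g : ℕ → _
  g j = cycle a v (e + j)
  rotated : ∀ j → cycle (g 0) (applyUpTo (g ∘ suc) l) j ≡ g j
  rotated j = begin
    cycle (g 0) (applyUpTo (g ∘ suc) l) j                ≡⟨ lookup-applyUpTo g (suc l) _ ⟩
    g (toℕ (j mod suc (length (applyUpTo (g ∘ suc) l)))) ≡⟨ cong g (toℕ-fromℕ< _) ⟩
    g (j % suc (length (applyUpTo (g ∘ suc) l)))         ≡⟨ cong (λ k → g (j % suc k)) (length-applyUpTo (g ∘ suc) l) ⟩
    g (j % suc l)                                        ≡⟨ cycle-cong-% a v (e + j % suc l) (e + j) ([m+n%o]%o≡[m+n]%o e j (suc l)) ⟩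
    g j                                                  ∎
    where open ≡-Reasoning

drop-power : ∀ {A : Set} (a : A) v q e →
  ∃₂ λ a′ v′ → length v′ ≡ length v × drop e (power a v q) ≡ power a′ v′ (q ∸ e)
drop-power a v q e with cycle-rotate a v e
... | a′ , v′ , |v′|≡|v| , rotated = a′ , v′ , |v′|≡|v| , (begin
  drop e (map (cycle a v) (upTo q))             ≡⟨ cong (drop e) (map-upTo (cycle a v) q) ⟩
  drop e (applyUpTo (cycle a v) q)              ≡⟨ drop-applyUpTo (cycle a v) e q ⟩
  applyUpTo (λ j → cycle a v (e + j)) (q ∸ e)   ≡⟨ applyUpTo-cong (sym ∘ rotated) (q ∸ e) ⟩
  applyUpTo (cycle a′ v′) (q ∸ e)               ≡⟨ map-upTo (cycle a′ v′) (q ∸ e) ⟨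
  map (cycle a′ v′) (upTo (q ∸ e))              ∎)
  where open ≡-Reasoning

ExpAbove-drop : ∀ {A : Set} {x y : ℚ} → x <ℚ y → (D : ℕ) →
  ∃ λ B → ∀ {z : List A} e → e ≤ D → B ≤ length z → ExpAbove z y → ExpAbove (drop e z) x
ExpAbove-drop {A} {x} {y} x<y D with trim-threshold x<y D
... | B , bound = B , trimmed
  where
  trimmed : ∀ {z : List A} e → e ≤ D → B ≤ length z → ExpAbove z y → ExpAbove (drop e z) x
  trimmed e e≤D B≤|z| (a , v , q , refl , y<q/L) with drop-power a v q e
  ... | a′ , v′ , |v′|≡|v| , dropped = a′ , v′ , q ∸ e , dropped ,
    subst (λ k → x <ℚ + (q ∸ e) / suc k) (sym |v′|≡|v|)
      (bound q (length v) e e≤D (subst (B ≤_) (length-power a v q) B≤|z|) y<q/L)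

ACEAbove-trim : ∀ {A : Set} {Fac Fac′ : List A → Set} (D : ℕ) →
  (∀ {z} → Fac z → ∃ λ e → e ≤ D × Fac′ (drop e z)) →
  ∀ {r} → ACEAbove Fac r → ACEAbove Fac′ r
ACEAbove-trim {A} {Fac} {Fac′} D trim {r} (r′ , r<r′ , long) = lowered (ℚP.<-dense r<r′)
  where
  lowered : (∃ λ r″ → r <ℚ r″ × r″ <ℚ r′) → ACEAbove Fac′ r
  lowered (r″ , r<r″ , r″<r′) = r″ , r<r″ , λ N → trimmed N (long (N + D + B))
    where
    threshold = ExpAbove-drop {A} r″<r′ D
    B = proj₁ threshold
    trimmed : ∀ N → Σ (List A) (λ z → Fac z × N + D + B ≤ length z × ExpAbove z r′) →
                    Σ (List A) (λ z → Fac′ z × N ≤ length z × ExpAbove z r″)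
    trimmed N (z , fac , long-z , exp) with trim fac
    ... | e , e≤D , fac′ = drop e z , fac′ , long-drop , proj₂ threshold e e≤D (≤-trans (m≤n+m B (N + D)) long-z) exp
      where
      long-drop : N ≤ length (drop e z)
      long-drop = subst (N ≤_) (sym (length-drop e z))
        (m+n≤o⇒m≤o∸n N (≤-trans (+-monoʳ-≤ N e≤D) (≤-trans (m≤m+n (N + D) B) long-z)))

prepend-< : ∀ {A : Set} (p : List A) u {i} (i<p : i < length p) → prepend p u i ≡ lookup p (fromℕ< i<p)
prepend-< p u {i} i<p with i <? length p
... | yes i<p′ = cong (lookup p) (fromℕ<-cong i i refl i<p′ i<p)
... | no  i≮p  = ⊥-elim (i≮p i<p)

prepend-≮ : ∀ {A : Set} (p : List A) u {i} → ¬ i < length p → prepend p u i ≡ u (i ∸ length p)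
prepend-≮ p u {i} i≮p with i <? length p
... | yes i<p = ⊥-elim (i≮p i<p)
... | no  _   = refl

prepend-suc : ∀ {A : Set} (a : A) p u i → prepend (a ∷ p) u (suc i) ≡ prepend p u i
prepend-suc a p u i = byCases (i <? length p)
  where
  byCases : Dec (i < length p) → prepend (a ∷ p) u (suc i) ≡ prepend p u i
  byCases (yes i<p) = trans (prepend-< (a ∷ p) u (s≤s i<p)) (sym (prepend-< p u i<p))
  byCases (no  i≮p) = trans (prepend-≮ (a ∷ p) u (i≮p ∘ s≤s⁻¹)) (sym (prepend-≮ p u i≮p))

prefix-prepend : ∀ {A : Set} (p : List A) u n → prefix (length p + n) (prepend p u) ≡ p ++ prefix n u
prefix-prepend p u n = begin
  prefix (length p + n) (prepend p u)        ≡⟨ map-upTo (prepend p u) (length p + n) ⟩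
  applyUpTo (prepend p u) (length p + n)     ≡⟨ applyUpTo-prepend p ⟩
  p ++ applyUpTo u n                         ≡⟨ cong (p ++_) (map-upTo u n) ⟨
  p ++ prefix n u                            ∎
  where
  open ≡-Reasoning
  applyUpTo-prepend : ∀ p → applyUpTo (prepend p u) (length p + n) ≡ p ++ applyUpTo u n
  applyUpTo-prepend []      = refl
  applyUpTo-prepend (a ∷ p) =
    cong (a ∷_) (trans (applyUpTo-cong (prepend-suc a p u) (length p + n)) (applyUpTo-prepend p))

factor-++ˡ : ∀ {A : Set} {z y : List A} x → FactorOfList z y → FactorOfList z (x ++ y)
factor-++ˡ x (s , t , y≡szt) = x ++ s , t , trans (cong (x ++_) y≡szt) (sym (++-assoc x s _))

factor-++ʳ : ∀ {A : Set} {z x : List A} y → FactorOfList z x → FactorOfList z (x ++ y)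
factor-++ʳ {z = z} y (s , t , x≡szt) = s , t ++ y , (begin
  _ ++ y               ≡⟨ cong (_++ y) x≡szt ⟩
  (s ++ z ++ t) ++ y   ≡⟨ ++-assoc s (z ++ t) y ⟩
  s ++ (z ++ t) ++ y   ≡⟨ cong (s ++_) (++-assoc z t y) ⟩
  s ++ z ++ t ++ y     ∎)
  where open ≡-Reasoning

factor-++-trimˡ : ∀ {A : Set} (P : List A) {Q z} → FactorOfList z (P ++ Q) →
  ∃ λ e → e ≤ length P × FactorOfList (drop e z) Q
factor-++-trimˡ []      fac = 0 , z≤n , fac
factor-++-trimˡ (_ ∷ P) {Q} {[]} ([] , t , eq) = 0 , z≤n , [] , Q , refl
factor-++-trimˡ (_ ∷ P) {Q} {_ ∷ z} ([] , t , eq) with factor-++-trimˡ P {Q} {z} ([] , t , ∷-injectiveʳ eq)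
... | e , e≤P , fac = suc e , s≤s e≤P , fac
factor-++-trimˡ (_ ∷ P) (_ ∷ s , t , eq) with factor-++-trimˡ P (s , t , ∷-injectiveʳ eq)
... | e , e≤P , fac = e , m≤n⇒m≤1+n e≤P , fac

module _ {S G : Set} (h : Morphism S G) where

  imageFactor-mono : ∀ {w : InfWord S} {z m n} → n ≤ m →
    FactorOfList z (ext h (prefix n w)) → FactorOfList z (ext h (prefix m w))
  imageFactor-mono {w} {z} {m} {n} n≤m fac =
    subst (λ k → FactorOfList z (ext h (prefix k w))) (m+[n∸m]≡n n≤m)
      (subst (FactorOfList z) (sym image-split) (factor-++ʳ _ fac))
    where
    open ≡-Reasoning
    rest = applyUpTo (λ i → w (n + i)) (m ∸ n)
    image-split : ext h (prefix (n + (m ∸ n)) w) ≡ ext h (prefix n w) ++ ext h rest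
    image-split = begin
      ext h (prefix (n + (m ∸ n)) w)         ≡⟨ cong (ext h) (map-upTo w (n + (m ∸ n))) ⟩
      ext h (applyUpTo w (n + (m ∸ n)))      ≡⟨ cong (ext h) (applyUpTo-+ w n (m ∸ n)) ⟩
      ext h (applyUpTo w n ++ rest)          ≡⟨ concatMap-++ h (applyUpTo w n) rest ⟩
      ext h (applyUpTo w n) ++ ext h rest    ≡⟨ cong (λ x → ext h x ++ ext h rest) (map-upTo w n) ⟨
      ext h (prefix n w) ++ ext h rest       ∎

  module _ {w u : InfWord S} (p : List S) (w≗pu : w ≗ prepend p u) where

    image-prefix-prepend : ∀ n → ext h (prefix (length p + n) w) ≡ ext h p ++ ext h (prefix n u)
    image-prefix-prepend n = begin
      ext h (prefix (length p + n) w)             ≡⟨ cong (ext h) (map-cong w≗pu (upTo (length p + n))) ⟩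
      ext h (prefix (length p + n) (prepend p u)) ≡⟨ cong (ext h) (prefix-prepend p u n) ⟩
      ext h (p ++ prefix n u)                     ≡⟨ concatMap-++ h p (prefix n u) ⟩
      ext h p ++ ext h (prefix n u)               ∎
      where open ≡-Reasoning

    imageFactor-prepend : ∀ {z} → FactorOfImage z h u → FactorOfImage z h w
    imageFactor-prepend (n , fac) =
      length p + n , subst (FactorOfList _) (sym (image-prefix-prepend n)) (factor-++ˡ (ext h p) fac)

    imageFactor-unprepend : ∀ {z} → FactorOfImage z h w →
      ∃ λ e → e ≤ length (ext h p) × FactorOfImage (drop e z) h u
    imageFactor-unprepend (n , fac)
      with factor-++-trimˡ (ext h p)
             (subst (FactorOfList _) (image-prefix-prepend n) (imageFactor-mono (m≤n+m n (length p)) fac))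
    ... | e , e≤|hp| , fac′ = e , e≤|hp| , n , fac′

module _ {S G : Set} {w u : InfWord S} (p : List S) (w≗pu : w ≗ prepend p u) where

  ACEIAbove-prepend : ∀ {r} → ACEIAbove G u r → ACEIAbove G w r
  ACEIAbove-prepend (h , inj , ace) =
    h , inj , ACEAbove-trim 0 (λ fac → 0 , z≤n , imageFactor-prepend h p w≗pu fac) ace

  ACEIAbove-unprepend : ∀ {r} → ACEIAbove G w r → ACEIAbove G u r
  ACEIAbove-unprepend (h , inj , ace) =
    h , inj , ACEAbove-trim (length (ext h p)) (imageFactor-unprepend h p w≗pu) ace

mainTheorem11 : (m k : ℕ) (w u : InfWord (Fin (suc (suc m)))) (p : List (Fin (suc (suc m)))) →
    (∀ i → w i ≡ prepend p u i) →
    (r : ℚ) →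
    (ACEIAbove (Fin (suc (suc k))) w r → ACEIAbove (Fin (suc (suc k))) u r) ×
    (ACEIAbove (Fin (suc (suc k))) u r → ACEIAbove (Fin (suc (suc k))) w r)
mainTheorem11 m k w u p w≗pu r = ACEIAbove-unprepend p w≗pu , ACEIAbove-prepend p w≗pu
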